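{- Let $G$ be a connected graph with a fixed vertex $v_0$, let $m \ge 2$, let $G(m)$ be as defined below, and let $i$ be a positive integer. (i) If $\mathcal{D}_w(G(m-1), i-1) = \emptyset$ and $\mathcal{D}_w(G(m-2), i-1) \ne \emptyset$, then $\mathcal{D}_w(G(m), i) = \{\{y_{m-1}\} \cup X : X \in \mathcal{D}_w(G(m-2), i-1)\}$. (ii) If $\mathcal{D}_w(G(m-2), i-1) \ne \emptyset$ and $\mathcal{D}_w(G(m-1), i-1) \ne \emptyset$, then $\mathcal{D}_w(G(m), i) = \{\{y_m\} \cup X_1 : X_1 \in \mathcal{D}_w(G(m-1), i-1)\} \cup \{\{y_{m-1}\} \cup X_2 : X_2 \in \mathcal{D}_w(G(m-2), i-1)\}$.
   Context: All graphs are finite and simple. For a connected graph $H$, a non-empty set $S \subseteq V(H)$ is a weakly connected dominating set of $H$ if the spanning subgraph of $H$ obtained by removing all edges joining two vertices of $V(H)\setminus S$ is connected. $\mathcal{D}_w(H,i)$ is the family of weakly connected dominating sets of $H$ of cardinality $i$. For $m\ge 0$, let $P_{m+1}$ be a path with vertices $y_0,y_1,\dots,y_m$ (edges $y_{k-1}y_k$); $G(m)$ is the graph obtained from $G$ and $P_{m+1}$ by identifying the vertex $v_0$ of $G$ with the end vertex $y_0$ of the path (so $G(0)=G$ and $G(k-1)$ is $G(k)$ with $y_k$ deleted). -}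

module Defs where

open import Data.Nat using (ℕ; zero; suc; _+_)
open import Data.Fin using (Fin; toℕ)
open import Data.Fin.Subset using (Subset; _∈_; ∣_∣; inside; outside)
open import Data.Vec using (_∷ʳ_)
open import Data.Sum using (_⊎_; inj₁; inj₂)
open import Data.Product using (_×_; ∃; _,_)
open import Relation.Nullary using (¬_)
open import Relation.Binary.PropositionalEquality using (_≡_)

record SimpleGraph : Set₁ where
  field
    n      : ℕ
    Adj    : Fin n → Fin n → Set
    sym    : ∀ {a b} → Adj a b → Adj b a
    irrefl : ∀ {a} → ¬ Adj a a
open SimpleGraph public

data Reach {V : Set} (E : V → V → Set) : V → V → Set where
  here : ∀ {v} → Reach E v v
  step : ∀ {u w v} → E u w → Reach E w v → Reach E u v

Connected : {V : Set} → (V → V → Set) → Set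
Connected {V} E = (u v : V) → Reach E u v

-- Vertices of G(m): inj₁ a is the vertex a of G (v₀ = y₀ among them),
-- inj₂ k (k : Fin m) is the path vertex y_{k+1}.
VG : SimpleGraph → ℕ → Set
VG G m = Fin (n G) ⊎ Fin m

-- Adjacency of G(m) = G with the path y₀ y₁ … y_m glued at y₀ = v₀.
AdjG : (G : SimpleGraph) → Fin (n G) → (m : ℕ) → VG G m → VG G m → Set
AdjG G v₀ m (inj₁ a) (inj₁ b) = Adj G a b
AdjG G v₀ m (inj₁ a) (inj₂ k) = (a ≡ v₀) × (toℕ k ≡ 0)
AdjG G v₀ m (inj₂ k) (inj₁ a) = (a ≡ v₀) × (toℕ k ≡ 0)
AdjG G v₀ m (inj₂ j) (inj₂ k) = (suc (toℕ j) ≡ toℕ k) ⊎ (suc (toℕ k) ≡ toℕ j)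

-- Vertex subsets of G(m): a subset of V(G) and a subset of {y₁,…,y_m}
-- (position k of the second component is y_{k+1}).
VSet : SimpleGraph → ℕ → Set
VSet G m = Subset (n G) × Subset m

_∈V_ : {G : SimpleGraph} {m : ℕ} → VG G m → VSet G m → Set
inj₁ a ∈V (A , B) = a ∈ A
inj₂ k ∈V (A , B) = k ∈ B

card : {G : SimpleGraph} {m : ℕ} → VSet G m → ℕ
card (A , B) = ∣ A ∣ + ∣ B ∣

IsWCDS : (G : SimpleGraph) → Fin (n G) → (m : ℕ) → VSet G m → Set
IsWCDS G v₀ m S =
  (∃ λ (v : VG G m) → _∈V_ {G} {m} v S) ×
  Connected (λ (u v : VG G m) → AdjG G v₀ m u v × (_∈V_ {G} {m} u S ⊎ _∈V_ {G} {m} v S))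

InDw : (G : SimpleGraph) → Fin (n G) → (m i : ℕ) → VSet G m → Set
InDw G v₀ m i S = IsWCDS G v₀ m S × (card {G} {m} S ≡ i)

DwNonempty : (G : SimpleGraph) → Fin (n G) → (m i : ℕ) → Set
DwNonempty G v₀ m i = ∃ λ (S : VSet G m) → InDw G v₀ m i S

-- {y_{m}} ∪ X for X ⊆ V(G(m-1)), as a subset of V(G(m)) (here m = suc m')
addLast : {G : SimpleGraph} {m : ℕ} → VSet G m → VSet G (suc m)
addLast (A , B) = A , (B ∷ʳ inside)

-- {y_{m-1}} ∪ X for X ⊆ V(G(m-2)), as a subset of V(G(m)) (m = suc (suc m'))
addPrev : {G : SimpleGraph} {m : ℕ} → VSet G m → VSet G (suc (suc m))
addPrev (A , B) = A , ((B ∷ʳ inside) ∷ʳ outside)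

module Submission where

-- G(m+1) arises from G(m) by attaching one new vertex y_{m+1}
-- to the path end y_m.  For a vertex set S of G(m+1) with trace X on G(m),
-- call the spanning subgraph keeping the edges with an endpoint in the set
-- its "kept" graph.  Two one-step facts carry the whole argument:
--   * restriction: if S has a connected kept graph in G(m+1), so does X in
--     G(m) (collapse y_{m+1} onto y_m: kept edges become kept edges or loops);
--   * extension: if X has a connected kept graph in G(m) and the edge
--     y_m y_{m+1} is kept (y_{m+1} ∈ S or y_m ∈ X), then so does S;
-- and, if neither y_m nor y_{m+1} is in S, then y_{m+1} is isolated.
-- Hence a weakly connected dominating set of G(m) (m ≥ 2) contains y_m, or
-- contains y_{m-1} but not y_m; peeling off these path vertices gives
-- 𝒟_w(G(m),i) ⊆ {y_m} ∪ 𝒟_w(G(m-1),i-1) ∪ {y_{m-1}} ∪ 𝒟_w(G(m-2),i-1), and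
-- extension gives the reverse inclusions.

open import Defs hiding (sym)
open import Data.Nat using (ℕ; zero; suc; _+_)
open import Data.Nat.Properties
  using (suc-injective; +-suc; <-irrefl; m<n⇒n≢0; m<n⇒m<1+n; m+n≡0⇒m≡0; m+n≡0⇒n≡0)
open import Data.Fin using (Fin; zero; suc; toℕ; fromℕ; inject₁)
open import Data.Fin.Properties using (toℕ-injective; toℕ<n; toℕ-fromℕ; toℕ-inject₁)
open import Data.Fin.Subset using (Subset; _∈_; _∉_; ∣_∣; inside; outside; Nonempty)
open import Data.Fin.Subset.Properties using (nonempty?; Empty-unique; ∣⊥∣≡0; x∈p⇒∣p-x∣<∣p∣)
open import Data.Vec using ([]; _∷_; _∷ʳ_; here; there; initLast)
open import Data.Sum using (_⊎_; inj₁; inj₂; [_,_]) renaming (map to ⊎-map; swap to ⊎-swap)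
open import Data.Product using (_×_; ∃; _,_; proj₁)
open import Data.Empty using (⊥-elim)
open import Function using (id; _∘′_)
open import Function.Bundles using (_⇔_; mk⇔)
open import Relation.Nullary using (¬_; yes; no)
open import Relation.Binary.PropositionalEquality
  using (_≡_; _≢_; refl; sym; trans; cong; cong₂; subst)

reach-trans : {V : Set} {E : V → V → Set} {u w v : V} → Reach E u w → Reach E w v → Reach E u v
reach-trans here        r′ = r′
reach-trans (step e r)  r′ = step e (reach-trans r r′)

reach-sym : {V : Set} {E : V → V → Set} → (∀ {u v} → E u v → E v u) →
  ∀ {u v} → Reach E u v → Reach E v u
reach-sym s here       = here
reach-sym s (step e r) = reach-trans (reach-sym s r) (step (s e) here)

reach-map : {V W : Set} {E : V → V → Set} {F : W → W → Set} (f : V → W) →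
  (∀ {u v} → E u v → f u ≡ f v ⊎ F (f u) (f v)) →
  ∀ {u v} → Reach E u v → Reach F (f u) (f v)
reach-map f h here = here
reach-map {F = F} f h {v = v} (step e r) with h e
... | inj₁ fu≡fw = subst (λ x → Reach F x (f v)) (sym fu≡fw) (reach-map f h r)
... | inj₂ e′    = step e′ (reach-map f h r)

∈-∷ʳ⁺ : ∀ {m} {B : Subset m} {r : Fin m} b → r ∈ B → inject₁ r ∈ B ∷ʳ b
∈-∷ʳ⁺ b here      = here
∈-∷ʳ⁺ b (there r) = there (∈-∷ʳ⁺ b r)

∈-∷ʳ⁻ : ∀ {m} (B : Subset m) (r : Fin m) b → inject₁ r ∈ B ∷ʳ b → r ∈ B
∈-∷ʳ⁻ (_ ∷ B) zero    b here      = here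
∈-∷ʳ⁻ (_ ∷ B) (suc r) b (there x) = there (∈-∷ʳ⁻ B r b x)

last-∈ : ∀ {m} (B : Subset m) → fromℕ m ∈ B ∷ʳ inside
last-∈ []      = here
last-∈ (_ ∷ B) = there (last-∈ B)

last-∉ : ∀ {m} (B : Subset m) → fromℕ m ∉ B ∷ʳ outside
last-∉ []      ()
last-∉ (_ ∷ B) (there x) = last-∉ B x

∣∷ʳinside∣ : ∀ {m} (B : Subset m) → ∣ B ∷ʳ inside ∣ ≡ suc ∣ B ∣
∣∷ʳinside∣ []            = refl
∣∷ʳinside∣ (inside ∷ B)  = cong suc (∣∷ʳinside∣ B)
∣∷ʳinside∣ (outside ∷ B) = ∣∷ʳinside∣ B

∣∷ʳoutside∣ : ∀ {m} (B : Subset m) → ∣ B ∷ʳ outside ∣ ≡ ∣ B ∣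
∣∷ʳoutside∣ []            = refl
∣∷ʳoutside∣ (inside ∷ B)  = cong suc (∣∷ʳoutside∣ B)
∣∷ʳoutside∣ (outside ∷ B) = ∣∷ʳoutside∣ B

∣p∣≡0-if-empty : ∀ {m} (p : Subset m) → ¬ Nonempty p → ∣ p ∣ ≡ 0
∣p∣≡0-if-empty {m} p ¬ne = trans (cong ∣_∣ (Empty-unique ¬ne)) (∣⊥∣≡0 m)

∣p∣≢0-if-∈ : ∀ {m} {p : Subset m} {x : Fin m} → x ∈ p → ∣ p ∣ ≢ 0
∣p∣≢0-if-∈ x∈p = m<n⇒n≢0 (x∈p⇒∣p-x∣<∣p∣ x∈p)

data EndView {m : ℕ} : Fin (suc m) → Set where
  isLast  : EndView (fromℕ m)
  isInner : (r : Fin m) → EndView (inject₁ r)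

endView : ∀ {m} (p : Fin (suc m)) → EndView p
endView {zero}  zero    = isLast
endView {suc m} zero    = isInner zero
endView {suc m} (suc p) with endView p
... | isLast    = isLast
... | isInner r = isInner (suc r)

endView-inject₁ : ∀ {m} (r : Fin m) → endView (inject₁ r) ≡ isInner r
endView-inject₁ zero    = refl
endView-inject₁ (suc r) rewrite endView-inject₁ r = refl

module Attach (G : SimpleGraph) (v₀ : Fin (n G)) where

  V : ℕ → Set
  V = VG G

  Adj′ : (m : ℕ) → V m → V m → Set
  Adj′ = AdjG G v₀

  _∈ₛ_ : ∀ {m} → V m → VSet G m → Set
  v ∈ₛ S = _∈V_ {G} v S

  Kept : (m : ℕ) → VSet G m → V m → V m → Set
  Kept m S u v = Adj′ m u v × (u ∈ₛ S ⊎ v ∈ₛ S)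

  Adj-sym : ∀ {m} {u v : V m} → Adj′ m u v → Adj′ m v u
  Adj-sym {u = inj₁ a} {inj₁ b} e = SimpleGraph.sym G e
  Adj-sym {u = inj₁ a} {inj₂ r} e = e
  Adj-sym {u = inj₂ r} {inj₁ a} e = e
  Adj-sym {u = inj₂ r} {inj₂ s} e = ⊎-swap e

  Kept-sym : ∀ {m} {S : VSet G m} {u v : V m} → Kept m S u v → Kept m S v u
  Kept-sym {u = u} {v} (e , s) = Adj-sym {u = u} {v} e , ⊎-swap s

  end : (m : ℕ) → V m
  end zero    = inj₁ v₀
  end (suc m) = inj₂ (fromℕ m)

  top : (m : ℕ) → V (suc m)
  top m = inj₂ (fromℕ m)

  ι : ∀ {m} → V m → V (suc m)
  ι (inj₁ a) = inj₁ a
  ι (inj₂ r) = inj₂ (inject₁ r)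

  ι-Adj : ∀ {m} (u v : V m) → Adj′ (suc m) (ι u) (ι v) ≡ Adj′ m u v
  ι-Adj (inj₁ a) (inj₁ b) = refl
  ι-Adj (inj₁ a) (inj₂ r) = cong (λ t → (a ≡ v₀) × (t ≡ 0)) (toℕ-inject₁ r)
  ι-Adj (inj₂ r) (inj₁ a) = cong (λ t → (a ≡ v₀) × (t ≡ 0)) (toℕ-inject₁ r)
  ι-Adj (inj₂ r) (inj₂ s) =
    cong₂ (λ x y → (suc x ≡ y) ⊎ (suc y ≡ x)) (toℕ-inject₁ r) (toℕ-inject₁ s)

  ι-∈⁺ : ∀ {m} {A B} b (w : V m) → w ∈ₛ (A , B) → ι w ∈ₛ (A , B ∷ʳ b)
  ι-∈⁺ b (inj₁ a) a∈A = a∈A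
  ι-∈⁺ b (inj₂ r) r∈B = ∈-∷ʳ⁺ b r∈B

  ι-∈⁻ : ∀ {m} {A B} b (w : V m) → ι w ∈ₛ (A , B ∷ʳ b) → w ∈ₛ (A , B)
  ι-∈⁻ b (inj₁ a) a∈A = a∈A
  ι-∈⁻ {B = B} b (inj₂ r) r∈B = ∈-∷ʳ⁻ B r b r∈B

  ι-Kept⁺ : ∀ {m} {A B} b {u v : V m} → Kept m (A , B) u v → Kept (suc m) (A , B ∷ʳ b) (ι u) (ι v)
  ι-Kept⁺ b {u} {v} (e , s) = subst id (sym (ι-Adj u v)) e , ⊎-map (ι-∈⁺ b u) (ι-∈⁺ b v) s

  ι-Kept⁻ : ∀ {m} {A B} b {u v : V m} → Kept (suc m) (A , B ∷ʳ b) (ι u) (ι v) → Kept m (A , B) u v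
  ι-Kept⁻ b {u} {v} (e , s) = subst id (ι-Adj u v) e , ⊎-map (ι-∈⁻ b u) (ι-∈⁻ b v) s

  data Vertex {m : ℕ} : V (suc m) → Set where
    isTop : Vertex (top m)
    isOld : (w : V m) → Vertex (ι w)

  vertex : ∀ {m} (u : V (suc m)) → Vertex u
  vertex (inj₁ a) = isOld (inj₁ a)
  vertex (inj₂ p) with endView p
  ... | isLast    = isTop
  ... | isInner r = isOld (inj₂ r)

  collapse : ∀ {m} {u : V (suc m)} → Vertex u → V m
  collapse {m} isTop = end m
  collapse (isOld w) = w

  π : ∀ {m} → V (suc m) → V m
  π u = collapse (vertex u)

  π-ι : ∀ {m} (w : V m) → π (ι w) ≡ w
  π-ι (inj₁ a) = refl
  π-ι (inj₂ r) rewrite endView-inject₁ r = refl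

  last-is-end : ∀ m (r : Fin m) → suc (toℕ r) ≡ m → inj₂ r ≡ end m
  last-is-end (suc m) r 1+r≡1+m =
    cong inj₂ (toℕ-injective (trans (suc-injective 1+r≡1+m) (sym (toℕ-fromℕ m))))

  top-neighbour : ∀ m (w : V m) → Adj′ (suc m) (top m) (ι w) → w ≡ end m
  top-neighbour zero    (inj₁ a) (a≡v₀ , _) = cong inj₁ a≡v₀
  top-neighbour (suc m) (inj₁ a) (_ , ())
  top-neighbour m (inj₂ r) adj
    with subst id (cong₂ (λ x y → (suc x ≡ y) ⊎ (suc y ≡ x)) (toℕ-fromℕ m) (toℕ-inject₁ r)) adj
  ... | inj₁ 1+m≡r = ⊥-elim (<-irrefl (sym 1+m≡r) (m<n⇒m<1+n (toℕ<n r)))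
  ... | inj₂ 1+r≡m = last-is-end m r 1+r≡m

  link : ∀ m → Adj′ (suc m) (top m) (ι (end m))
  link zero    = refl , refl
  link (suc m) = inj₂ (cong suc (toℕ-inject₁ (fromℕ m)))

  π-Kept : ∀ {m} {A B} b {u v : V (suc m)} → Kept (suc m) (A , B ∷ʳ b) u v →
    π u ≡ π v ⊎ Kept m (A , B) (π u) (π v)
  π-Kept {m} b {u} {v} e with vertex u | vertex v
  ... | isTop   | isTop    = inj₁ refl
  ... | isTop   | isOld w  = inj₁ (sym (top-neighbour m w (proj₁ e)))
  ... | isOld w | isTop    = inj₁ (top-neighbour m w (Adj-sym {u = ι w} {top m} (proj₁ e)))
  ... | isOld w | isOld w′ = inj₂ (ι-Kept⁻ b e)

  restrict : ∀ {m} {A B} b → Connected (Kept (suc m) (A , B ∷ʳ b)) → Connected (Kept m (A , B))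
  restrict {m} {A} {B} b c u v =
    subst (λ x → Reach (Kept m (A , B)) x v) (π-ι u)
      (subst (Reach (Kept m (A , B)) (π (ι u))) (π-ι v)
        (reach-map π (π-Kept b) (c (ι u) (ι v))))

  extend : ∀ {m} {A B} b → Connected (Kept m (A , B)) → (b ≡ inside ⊎ end m ∈ₛ (A , B)) →
    Connected (Kept (suc m) (A , B ∷ʳ b))
  extend {m} {A} {B} b c link-kept u v =
    reach-trans (home u)
      (reach-trans (reach-map ι (λ e → inj₂ (ι-Kept⁺ b e)) (c (π u) (π v)))
        (reach-sym Kept-sym (home v)))
    where
    S′ : VSet G (suc m)
    S′ = A , B ∷ʳ b

    link′ : Kept (suc m) S′ (top m) (ι (end m))
    link′ = link m , ⊎-map (λ b≡inside → subst (λ x → fromℕ m ∈ B ∷ʳ x) (sym b≡inside) (last-∈ B))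
                           (ι-∈⁺ b (end m)) link-kept

    home : ∀ u → Reach (Kept (suc m) S′) u (ι (π u))
    home u with vertex u
    ... | isTop   = step link′ here
    ... | isOld w = here

  disconnected : ∀ {m} {A B} → ¬ (end m ∈ₛ (A , B)) → ¬ Connected (Kept (suc m) (A , B ∷ʳ outside))
  disconnected {m} {A} {B} y∉X c with c (top m) (inj₁ v₀)
  ... | step e _ = isolated e
    where
    isolated : ∀ {u} → ¬ Kept (suc m) (A , B ∷ʳ outside) (top m) u
    isolated {u} (adj , s) with vertex u
    ... | isTop   = [ last-∉ B , last-∉ B ] s
    ... | isOld w = [ last-∉ B , (λ ιw∈S → y∉X (subst (_∈ₛ (A , B)) (top-neighbour m w adj)
                                                       (ι-∈⁻ outside w ιw∈S))) ] s

  card-∷ʳinside : ∀ {m} A (B : Subset m) → card {G} (A , B ∷ʳ inside) ≡ suc (card {G} (A , B))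
  card-∷ʳinside A B = trans (cong (∣ A ∣ +_) (∣∷ʳinside∣ B)) (+-suc ∣ A ∣ ∣ B ∣)

  card-∷ʳoutside : ∀ {m} A (B : Subset m) → card {G} (A , B ∷ʳ outside) ≡ card {G} (A , B)
  card-∷ʳoutside A B = cong (∣ A ∣ +_) (∣∷ʳoutside∣ B)

  card≢0-if-∈ : ∀ {m} (S : VSet G m) {v : V m} → v ∈ₛ S → card {G} S ≢ 0
  card≢0-if-∈ (A , B) {inj₁ a} a∈A = ∣p∣≢0-if-∈ a∈A ∘′ m+n≡0⇒m≡0 ∣ A ∣
  card≢0-if-∈ (A , B) {inj₂ r} r∈B = ∣p∣≢0-if-∈ r∈B ∘′ m+n≡0⇒n≡0 ∣ A ∣

  ∈-if-card≢0 : ∀ {m} (S : VSet G m) → card {G} S ≢ 0 → ∃ λ v → v ∈ₛ S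
  ∈-if-card≢0 (A , B) card≢0 with nonempty? A | nonempty? B
  ... | yes (a , a∈A) | _             = inj₁ a , a∈A
  ... | no _          | yes (r , r∈B) = inj₂ r , r∈B
  ... | no ¬neA       | no ¬neB       = ⊥-elim (card≢0 (cong₂ _+_ (∣p∣≡0-if-empty A ¬neA) (∣p∣≡0-if-empty B ¬neB)))

  Dw-index≢0 : ∀ {m i} → DwNonempty G v₀ m i → i ≢ 0
  Dw-index≢0 (S , ((v , v∈S) , _) , card≡i) = subst (_≢ 0) card≡i (card≢0-if-∈ S v∈S)

  extend-wcds : ∀ {m} {A B} b → IsWCDS G v₀ m (A , B) → (b ≡ inside ⊎ end m ∈ₛ (A , B)) →
    IsWCDS G v₀ (suc m) (A , B ∷ʳ b)
  extend-wcds b ((w , w∈X) , c) link-kept = (ι w , ι-∈⁺ b w w∈X) , extend b c link-kept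

  addLast-InDw : ∀ {m j} (X : VSet G m) → InDw G v₀ m j X → InDw G v₀ (suc m) (suc j) (addLast {G} X)
  addLast-InDw (A , B) (wcds , card≡j) =
    extend-wcds inside wcds (inj₁ refl) , trans (card-∷ʳinside A B) (cong suc card≡j)

  addPrev-InDw : ∀ {m j} (X : VSet G m) → InDw G v₀ m j X → InDw G v₀ (suc (suc m)) (suc j) (addPrev {G} X)
  addPrev-InDw (A , B) inDw with addLast-InDw (A , B) inDw
  ... | wcds , card≡1+j =
    extend-wcds outside wcds (inj₂ (last-∈ B)) , trans (card-∷ʳoutside A (B ∷ʳ inside)) card≡1+j

  restrict-InDw : ∀ {m j} {A B} b → j ≢ 0 → Connected (Kept (suc m) (A , B ∷ʳ b)) →
    card {G} (A , B) ≡ j → InDw G v₀ m j (A , B)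
  restrict-InDw {A = A} {B} b j≢0 c card≡j =
    (∈-if-card≢0 (A , B) (subst (_≢ 0) (sym card≡j) j≢0) , restrict b c) , card≡j

  decompose : ∀ k j → j ≢ 0 → (S : VSet G (suc (suc k))) → InDw G v₀ (suc (suc k)) (suc j) S →
    (∃ λ (X₁ : VSet G (suc k)) → InDw G v₀ (suc k) j X₁ × (S ≡ addLast {G} X₁))
    ⊎ (∃ λ (X₂ : VSet G k) → InDw G v₀ k j X₂ × (S ≡ addPrev {G} X₂))
  decompose k j j≢0 (A , B) ((_ , c) , card≡) with initLast B
  ... | ys , inside , refl =
    inj₁ ((A , ys) , restrict-InDw inside j≢0 c (suc-injective (trans (sym (card-∷ʳinside A ys)) card≡)) , refl)
  ... | ys , outside , refl with initLast ys
  ...   | zs , inside , refl =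
    inj₂ ((A , zs) , restrict-InDw inside j≢0 (restrict outside c) (suc-injective card-zs) , refl)
    where
    card-zs : suc (card {G} (A , zs)) ≡ suc j
    card-zs = trans (sym (trans (card-∷ʳoutside A (zs ∷ʳ inside)) (card-∷ʳinside A zs))) card≡
  ...   | zs , outside , refl = ⊥-elim (disconnected (last-∉ zs) c)

  recurrence-i : ∀ k j → ¬ DwNonempty G v₀ (suc k) j → DwNonempty G v₀ k j →
    (S : VSet G (suc (suc k))) →
    InDw G v₀ (suc (suc k)) (suc j) S ⇔ (∃ λ (X : VSet G k) → InDw G v₀ k j X × (S ≡ addPrev {G} X))
  recurrence-i k j ¬Dw₁ Dw₀ S = mk⇔
    (λ S∈Dw → [ (λ { (X₁ , X₁∈Dw , _) → ⊥-elim (¬Dw₁ (X₁ , X₁∈Dw)) }) , id ]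
                (decompose k j (Dw-index≢0 Dw₀) S S∈Dw))
    (λ { (X , X∈Dw , refl) → addPrev-InDw X X∈Dw })

  recurrence-ii : ∀ k j → DwNonempty G v₀ k j → (S : VSet G (suc (suc k))) →
    InDw G v₀ (suc (suc k)) (suc j) S ⇔
      ((∃ λ (X₁ : VSet G (suc k)) → InDw G v₀ (suc k) j X₁ × (S ≡ addLast {G} X₁))
       ⊎ (∃ λ (X₂ : VSet G k) → InDw G v₀ k j X₂ × (S ≡ addPrev {G} X₂)))
  recurrence-ii k j Dw₀ S = mk⇔
    (decompose k j (Dw-index≢0 Dw₀) S)
    [ (λ { (X₁ , X₁∈Dw , refl) → addLast-InDw X₁ X₁∈Dw })
    , (λ { (X₂ , X₂∈Dw , refl) → addPrev-InDw X₂ X₂∈Dw }) ]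

theorem3p4 : (G : SimpleGraph) (v₀ : Fin (n G)) → Connected (Adj G) →
    (k j : ℕ) →
    ((¬ DwNonempty G v₀ (suc k) j) → DwNonempty G v₀ k j →
      (S : VSet G (suc (suc k))) →
      InDw G v₀ (suc (suc k)) (suc j) S ⇔
        (∃ λ (X : VSet G k) → InDw G v₀ k j X × (S ≡ addPrev {G} {k} X)))
    ×
    (DwNonempty G v₀ k j → DwNonempty G v₀ (suc k) j →
      (S : VSet G (suc (suc k))) →
      InDw G v₀ (suc (suc k)) (suc j) S ⇔
        ((∃ λ (X₁ : VSet G (suc k)) → InDw G v₀ (suc k) j X₁ × (S ≡ addLast {G} {suc k} X₁))
         ⊎ (∃ λ (X₂ : VSet G k) → InDw G v₀ k j X₂ × (S ≡ addPrev {G} {k} X₂))))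
theorem3p4 G v₀ _ k j =
  (λ ¬Dw₁ Dw₀ → recurrence-i k j ¬Dw₁ Dw₀) , (λ Dw₀ _ → recurrence-ii k j Dw₀)
  where open Attach G v₀
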